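{- Let $M$ be a loopless matroid on a finite ground set $E$. Then $\widetilde{\chi}(M)=\chi(M)$.
   Context: A coloring of $E$ (assigning one color to each element) is proper if every color class is an independent set of $M$. The chromatic number $\chi(M)$ is the minimum number of colors in a proper coloring of $M$. For a positive integer $k$, consider the following game between Alice and Bob on $M$, with colors $1,2,3,\dots$. In round $i=1,2,\dots$, Bob chooses a non-empty set $B_i\subseteq E$ and inserts color $i$ into the lists of all elements of $B_i$ (each list may contain at most $k$ colors, so Bob may only choose elements whose lists currently have fewer than $k$ colors); then Alice chooses an independent set $A_i\subseteq B_i\setminus(A_1\cup\dots\cup A_{i-1})$ and colors its elements with color $i$. The game ends when every element's list contains exactly $k$ colors. Alice wins if at the end every element of $E$ is colored; otherwise Bob wins. $\widetilde{\chi}(M)$ denotes the minimum $k$ for which Alice has a winning strategy. -}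

module Defs where

open import Data.Nat using (ℕ; zero; suc; _<_; _≤_)
open import Data.Fin using (Fin; _≟_)
open import Data.Fin.Subset using (Subset; _∈_; _∉_; _⊆_; _∪_; _─_; ∣_∣; ⁅_⁆; Nonempty)
import Data.Fin.Subset as S
open import Data.Vec using (tabulate)
open import Data.Bool using (Bool; true; false; if_then_else_)
open import Data.Product using (Σ; ∃; _×_)
open import Relation.Nullary using (¬_; Dec; does)
open import Relation.Unary using (Decidable)
open import Relation.Binary.PropositionalEquality using (_≡_)
open import Data.Vec using (lookup)

record Matroid (n : ℕ) : Set₁ where
  field
    Indep      : Subset n → Set
    indep?     : Decidable Indep
    indep-∅    : Indep S.⊥
    hereditary : ∀ {I J} → I ⊆ J → Indep J → Indep I
    exchange   : ∀ {I J} → Indep I → Indep J → ∣ I ∣ < ∣ J ∣ →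
                 ∃ λ e → e ∈ J × e ∉ I × Indep (I ∪ ⁅ e ⁆)
open Matroid public

Loopless : ∀ {n} → Matroid n → Set
Loopless {n} M = (e : Fin n) → Indep M ⁅ e ⁆

colorClass : ∀ {n k} → (Fin n → Fin k) → Fin k → Subset n
colorClass f c = tabulate (λ e → does (f e ≟ c))

ProperColoring : ∀ {n} → Matroid n → (k : ℕ) → (Fin n → Fin k) → Set
ProperColoring M k f = ∀ c → Indep M (colorClass f c)

Colorable : ∀ {n} → Matroid n → ℕ → Set
Colorable {n} M k = Σ (Fin n → Fin k) (ProperColoring M k)

IsMinimum : (ℕ → Set) → ℕ → Set
IsMinimum P m = P m × (∀ k → P k → m ≤ k)

-- Game state: for each element the current size of its list, and the set
-- of already-colored elements (colors in the lists never influence the rules).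
Sizes : ℕ → Set
Sizes n = Fin n → ℕ

insert : ∀ {n} → Subset n → Sizes n → Sizes n
insert B s e = if lookup B e then suc (s e) else s e

LegalBob : ∀ {n} → ℕ → Sizes n → Subset n → Set
LegalBob k s B = Nonempty B × (∀ e → e ∈ B → s e < k)

Ended : ∀ {n} → ℕ → Sizes n → Set
Ended k s = ∀ e → s e ≡ k

-- Alice has a winning strategy from the position (s , col) in the game
-- with list size k (the game is finite, so an inductive definition suffices).
data AliceWinsFrom {n} (M : Matroid n) (k : ℕ) (s : Sizes n) (col : Subset n) : Set where
  finished : Ended k s → (∀ e → e ∈ col) → AliceWinsFrom M k s col
  round    : ¬ Ended k s →
             (∀ B → LegalBob k s B →
                ∃ λ A → A ⊆ (B ─ col) × Indep M A ×
                        AliceWinsFrom M k (insert B s) (col ∪ A)) →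
             AliceWinsFrom M k s col

AliceWins : ∀ {n} → Matroid n → ℕ → Set
AliceWins M k = AliceWinsFrom M k (λ _ → 0) S.⊥

-- The lower bound is Bob's simplest strategy: if he inserts a new color into every list in every round,
-- Alice's k answers are independent sets covering the ground set, i.e. a proper k-coloring.
--
-- For the upper bound Alice maintains a list of independent sets such that every uncolored element
-- lies in one of the first (k − size of its list) sets; initially these are the color classes of an
-- optimal coloring. When Bob offers B, the list is refined from its end: each set J splits into
-- J ∩ B, which joins Alice's answer, and J ─ B, which stays in place, while the part Y of the answer
-- built from the later sets is shared out between the two halves. That this is possible is a matroid
-- exchange lemma: if P ∪ Q is independent (P, Q disjoint) and Y is independent, then Y ⊆ A ∪ R with
-- P ∪ A and Q ∪ R independent. It is proved by shrinking the sides each element of Y may join while a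
-- Rado-type rank inequality survives; submodularity shows that one of the two shrinkings always does.
module Submission where

open import Defs
open import Algebra.Properties.CommutativeSemigroup using (interchange)
open import Data.Bool using (true; false; if_then_else_)
open import Data.Empty using (⊥-elim) renaming (⊥ to ⊥₀)
open import Data.Fin using (Fin; zero; suc; toℕ; fromℕ<)
import Data.Fin.Properties as Fin
open import Data.Fin.Subset
open import Data.Fin.Subset.Properties
open import Data.List using (List; []; _∷_; take)
import Data.List as List
open import Data.List.Properties using (take-all; length-tabulate)
import Data.List.Membership.Propositional as List
open import Data.List.Membership.Propositional.Properties using (∈-allFin)
open import Data.List.Relation.Unary.All using (All; []; _∷_)
import Data.List.Relation.Unary.All.Properties as All
open import Data.List.Relation.Unary.Any using (Any; here; there)
import Data.List.Relation.Unary.Any.Properties as Any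
open import Data.Nat using (ℕ; zero; suc; _+_; _∸_; _≤_; _<_; _≤?_; _<?_; _≟_; z≤n; s≤s; z<s)
open import Data.Nat.Induction using (<-wellFounded)
open import Data.Nat.Properties
open import Data.Product using (Σ; ∃; _×_; _,_; proj₁; proj₂; map₁)
open import Data.Sum using (_⊎_; inj₁; inj₂; [_,_]′)
open import Data.Vec using ([]; _∷_; there; lookup; tabulate)
open import Data.Vec.Properties using ([]=⇒lookup; lookup⇒[]=; lookup∘tabulate)
open import Induction.WellFounded using (Acc; acc)
open import Relation.Nullary using (¬_; Dec; yes; no; does)
open import Relation.Nullary.Decidable using (dec-true; _×-dec_)
open import Relation.Binary.PropositionalEquality

open ≤-Reasoning

+-interchange : ∀ a b c d → (a + b) + (c + d) ≡ (a + c) + (b + d)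
+-interchange = interchange +-commutativeSemigroup

m∸n≡1+[m∸1+n] : ∀ {m n} → n < m → m ∸ n ≡ suc (m ∸ suc n)
m∸n≡1+[m∸1+n] {suc m} {zero}  _          = refl
m∸n≡1+[m∸1+n] {suc m} {suc n} (s≤s n<m) = m∸n≡1+[m∸1+n] n<m

-- Finite subsets

∣p∪q∣+∣p∩q∣≡∣p∣+∣q∣ : ∀ {n} (p q : Subset n) → ∣ p ∪ q ∣ + ∣ p ∩ q ∣ ≡ ∣ p ∣ + ∣ q ∣
∣p∪q∣+∣p∩q∣≡∣p∣+∣q∣ []          []          = refl
∣p∪q∣+∣p∩q∣≡∣p∣+∣q∣ (true ∷ p)  (true ∷ q)  =
  cong suc (trans (+-suc _ _) (trans (cong suc (∣p∪q∣+∣p∩q∣≡∣p∣+∣q∣ p q)) (sym (+-suc _ _))))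
∣p∪q∣+∣p∩q∣≡∣p∣+∣q∣ (true ∷ p)  (false ∷ q) = cong suc (∣p∪q∣+∣p∩q∣≡∣p∣+∣q∣ p q)
∣p∪q∣+∣p∩q∣≡∣p∣+∣q∣ (false ∷ p) (true ∷ q)  =
  trans (cong suc (∣p∪q∣+∣p∩q∣≡∣p∣+∣q∣ p q)) (sym (+-suc _ _))
∣p∪q∣+∣p∩q∣≡∣p∣+∣q∣ (false ∷ p) (false ∷ q) = ∣p∪q∣+∣p∩q∣≡∣p∣+∣q∣ p q

∣p∪q∣≤∣p∣+∣q∣ : ∀ {n} (p q : Subset n) → ∣ p ∪ q ∣ ≤ ∣ p ∣ + ∣ q ∣
∣p∪q∣≤∣p∣+∣q∣ p q = subst (∣ p ∪ q ∣ ≤_) (∣p∪q∣+∣p∩q∣≡∣p∣+∣q∣ p q) (m≤m+n _ _)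

∣p∪q∣≡∣p∣+∣q∣ : ∀ {n} (p q : Subset n) → Empty (p ∩ q) → ∣ p ∪ q ∣ ≡ ∣ p ∣ + ∣ q ∣
∣p∪q∣≡∣p∣+∣q∣ {n} p q disjoint = begin-equality
  ∣ p ∪ q ∣              ≡⟨ sym (+-identityʳ _) ⟩
  ∣ p ∪ q ∣ + 0          ≡⟨ cong (∣ p ∪ q ∣ +_) (sym ∣p∩q∣≡0) ⟩
  ∣ p ∪ q ∣ + ∣ p ∩ q ∣  ≡⟨ ∣p∪q∣+∣p∩q∣≡∣p∣+∣q∣ p q ⟩
  ∣ p ∣ + ∣ q ∣          ∎
  where
  ∣p∩q∣≡0 : ∣ p ∩ q ∣ ≡ 0
  ∣p∩q∣≡0 = trans (cong ∣_∣ (Empty-unique disjoint)) (∣⊥∣≡0 n)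

∣p∣≤1+∣p-x∣ : ∀ {n} (p : Subset n) (x : Fin n) → ∣ p ∣ ≤ suc ∣ p - x ∣
∣p∣≤1+∣p-x∣ p x = begin
  ∣ p ∣                    ≤⟨ p⊆q⇒∣p∣≤∣q∣ p⊆[p-x]∪⁅x⁆ ⟩
  ∣ (p - x) ∪ ⁅ x ⁆ ∣      ≤⟨ ∣p∪q∣≤∣p∣+∣q∣ (p - x) ⁅ x ⁆ ⟩
  ∣ p - x ∣ + ∣ ⁅ x ⁆ ∣    ≡⟨ cong (∣ p - x ∣ +_) (∣⁅x⁆∣≡1 x) ⟩
  ∣ p - x ∣ + 1            ≡⟨ +-comm _ 1 ⟩
  suc ∣ p - x ∣            ∎
  where
  p⊆[p-x]∪⁅x⁆ : p ⊆ (p - x) ∪ ⁅ x ⁆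
  p⊆[p-x]∪⁅x⁆ {z} z∈p with z Fin.≟ x
  ... | yes refl = q⊆p∪q (p - x) ⁅ x ⁆ (x∈⁅x⁆ x)
  ... | no  z≢x  = p⊆p∪q ⁅ x ⁆ (x∈p∧x≢y⇒x∈p-y z∈p z≢x)

p⊆q∧∣q∣≤∣p∣⇒q⊆p : ∀ {n} {p q : Subset n} → p ⊆ q → ∣ q ∣ ≤ ∣ p ∣ → q ⊆ p
p⊆q∧∣q∣≤∣p∣⇒q⊆p {p = p} p⊆q ∣q∣≤∣p∣ {x} x∈q with x ∈? p
... | yes x∈p = x∈p
... | no  x∉p = ⊥-elim (<⇒≱ (p⊂q⇒∣p∣<∣q∣ (p⊆q , x , x∈q , x∉p)) ∣q∣≤∣p∣)

x∈p─q⇒x∉q : ∀ {n} {x : Fin n} (p q : Subset n) → x ∈ p ─ q → x ∉ q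
x∈p─q⇒x∉q {x = zero} (_ ∷ p) (true ∷ q)  ()         _
x∈p─q⇒x∉q {x = zero} (_ ∷ p) (false ∷ q) _          ()
x∈p─q⇒x∉q {x = suc x} (_ ∷ p) (_ ∷ q)     (there m) (there k) = x∈p─q⇒x∉q p q m k

x∈p-y⇒x≢y : ∀ {n} {x y : Fin n} (p : Subset n) → x ∈ p - y → x ≢ y
x∈p-y⇒x≢y {y = y} p x∈p-y = x∉⁅y⁆⇒x≢y (x∈p─q⇒x∉q p ⁅ y ⁆ x∈p-y)

x∈tabulate⁺ : ∀ {n} {f : Fin n → _} {x} → f x ≡ true → x ∈ tabulate f
x∈tabulate⁺ {f = f} {x} fx≡true = lookup⇒[]= x (tabulate f) (trans (lookup∘tabulate f x) fx≡true)

x∈tabulate⁻ : ∀ {n} {f : Fin n → _} {x} → x ∈ tabulate f → f x ≡ true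
x∈tabulate⁻ {f = f} {x} x∈t = trans (sym (lookup∘tabulate f x)) ([]=⇒lookup x∈t)

∪-monoʳ-⊆ : ∀ {n} (p : Subset n) {q q′} → q ⊆ q′ → p ∪ q ⊆ p ∪ q′
∪-monoʳ-⊆ p {q} q⊆q′ x∈ = [ p⊆p∪q _ , (λ x∈q → q⊆p∪q p _ (q⊆q′ x∈q)) ]′ (x∈p∪q⁻ p q x∈)

y∉p⇒p∩q⊆p∩[q-y] : ∀ {n} {p q : Subset n} {y} → y ∉ p → p ∩ q ⊆ p ∩ (q - y)
y∉p⇒p∩q⊆p∩[q-y] {p = p} {q} y∉p x∈ with x∈p∩q⁻ p q x∈
... | x∈p , x∈q = x∈p∩q⁺ (x∈p , x∈p∧x≢y⇒x∈p-y x∈q (λ { refl → y∉p x∈p }))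

y∈q⇒p∪q⊆[p-y]∪q : ∀ {n} {p q : Subset n} {y} → y ∈ q → p ∪ q ⊆ (p - y) ∪ q
y∈q⇒p∪q⊆[p-y]∪q {p = p} {q} {y} y∈q {x} x∈ with x∈p∪q⁻ p q x∈
... | inj₂ x∈q = q⊆p∪q (p - y) q x∈q
... | inj₁ x∈p with x Fin.≟ y
...   | yes refl = q⊆p∪q (p - y) q y∈q
...   | no  x≢y  = p⊆p∪q q (x∈p∧x≢y⇒x∈p-y x∈p x≢y)

y∈p⇒p∪q⊆p∪[q-y] : ∀ {n} {p q : Subset n} {y} → y ∈ p → p ∪ q ⊆ p ∪ (q - y)
y∈p⇒p∪q⊆p∪[q-y] {p = p} {q} {y} y∈p =
  subst₂ _⊆_ (∪-comm q p) (∪-comm (q - y) p) (y∈q⇒p∪q⊆[p-y]∪q y∈p)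

colorClass⁺ : ∀ {n k} (f : Fin n → Fin k) (e : Fin n) → e ∈ colorClass f (f e)
colorClass⁺ f e = x∈tabulate⁺ (dec-true (f e Fin.≟ f e) refl)

colorClass⁻ : ∀ {n k} (f : Fin n → Fin k) {c e} → e ∈ colorClass f c → f e ≡ c
colorClass⁻ f {c} {e} e∈class with f e Fin.≟ c | x∈tabulate⁻ {f = λ x → does (f x Fin.≟ c)} e∈class
... | yes fe≡c | _  = fe≡c
... | no  _    | ()

-- Rank of a matroid

module Rank {n : ℕ} (M : Matroid n) where

  maximal⇒maximum : ∀ {K X J} → Indep M K → (∀ e → e ∈ X → Indep M (K ∪ ⁅ e ⁆) → e ∈ K) →
                    Indep M J → J ⊆ X → ∣ J ∣ ≤ ∣ K ∣
  maximal⇒maximum {K} {X} {J} indK maximal indJ J⊆X with ∣ J ∣ ≤? ∣ K ∣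
  ... | yes ∣J∣≤∣K∣ = ∣J∣≤∣K∣
  ... | no  ∣J∣≰∣K∣ with exchange M indK indJ (≰⇒> ∣J∣≰∣K∣)
  ...   | e , e∈J , e∉K , indK+e = ⊥-elim (e∉K (maximal e (J⊆X e∈J) indK+e))

  greedy : Subset n → List (Fin n) → Subset n → Subset n
  greedy X []       C = C
  greedy X (e ∷ es) C with (e ∈? X) ×-dec indep? M (C ∪ ⁅ e ⁆)
  ... | yes _ = greedy X es (C ∪ ⁅ e ⁆)
  ... | no  _ = greedy X es C

  greedy-indep : ∀ X es {C} → Indep M C → Indep M (greedy X es C)
  greedy-indep X []       indC = indC
  greedy-indep X (e ∷ es) {C} indC with (e ∈? X) ×-dec indep? M (C ∪ ⁅ e ⁆)
  ... | yes (_ , indC+e) = greedy-indep X es indC+e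
  ... | no  _            = greedy-indep X es indC

  greedy-⊇ : ∀ X es {C} → C ⊆ greedy X es C
  greedy-⊇ X []       x∈C = x∈C
  greedy-⊇ X (e ∷ es) {C} x∈C with (e ∈? X) ×-dec indep? M (C ∪ ⁅ e ⁆)
  ... | yes _ = greedy-⊇ X es (p⊆p∪q ⁅ e ⁆ x∈C)
  ... | no  _ = greedy-⊇ X es x∈C

  greedy-⊆ : ∀ X es {C} → greedy X es C ⊆ C ∪ X
  greedy-⊆ X []       x∈C = p⊆p∪q X x∈C
  greedy-⊆ X (e ∷ es) {C} {x} x∈G with (e ∈? X) ×-dec indep? M (C ∪ ⁅ e ⁆)
  ... | no  _ = greedy-⊆ X es x∈G
  ... | yes (e∈X , _) with x∈p∪q⁻ (C ∪ ⁅ e ⁆) X (greedy-⊆ X es x∈G)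
  ...   | inj₂ x∈X = q⊆p∪q C X x∈X
  ...   | inj₁ x∈C+e with x∈p∪q⁻ C ⁅ e ⁆ x∈C+e
  ...     | inj₁ x∈C = p⊆p∪q X x∈C
  ...     | inj₂ x∈⁅e⁆ = q⊆p∪q C X (subst (_∈ X) (sym (x∈⁅y⁆⇒x≡y e x∈⁅e⁆)) e∈X)

  greedy-maximal : ∀ X es {C} e → e List.∈ es → e ∈ X →
                   Indep M (greedy X es C ∪ ⁅ e ⁆) → e ∈ greedy X es C
  greedy-maximal X (e ∷ es) {C} .e (here refl) e∈X indG+e
    with (e ∈? X) ×-dec indep? M (C ∪ ⁅ e ⁆)
  ... | yes _  = greedy-⊇ X es (q⊆p∪q C ⁅ e ⁆ (x∈⁅x⁆ e))
  ... | no  ¬a = ⊥-elim (¬a (e∈X , hereditary M C+e⊆G+e indG+e))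
    where
    C+e⊆G+e : C ∪ ⁅ e ⁆ ⊆ greedy X es C ∪ ⁅ e ⁆
    C+e⊆G+e x∈ = [ (λ x∈C → p⊆p∪q ⁅ e ⁆ (greedy-⊇ X es x∈C)) , q⊆p∪q _ ⁅ e ⁆ ]′ (x∈p∪q⁻ C ⁅ e ⁆ x∈)
  greedy-maximal X (f ∷ es) {C} e (there e∈es) e∈X indG+e
    with (f ∈? X) ×-dec indep? M (C ∪ ⁅ f ⁆)
  ... | yes _ = greedy-maximal X es e e∈es e∈X indG+e
  ... | no  _ = greedy-maximal X es e e∈es e∈X indG+e

  -- For independent C, a maximal independent subset of C ∪ X containing C.
  extend : Subset n → Subset n → Subset n
  extend C X = greedy X (List.allFin n) C

  extend-maximal : ∀ C X e → e ∈ X → Indep M (extend C X ∪ ⁅ e ⁆) → e ∈ extend C X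
  extend-maximal C X e = greedy-maximal X (List.allFin n) e (∈-allFin e)

  basis : Subset n → Subset n
  basis = extend ⊥

  basis-indep : ∀ X → Indep M (basis X)
  basis-indep X = greedy-indep X (List.allFin n) (indep-∅ M)

  basis-⊆ : ∀ X → basis X ⊆ X
  basis-⊆ X x∈B = [ (λ x∈⊥ → ⊥-elim (∉⊥ x∈⊥)) , (λ x∈X → x∈X) ]′
                    (x∈p∪q⁻ ⊥ X (greedy-⊆ X (List.allFin n) x∈B))

  r : Subset n → ℕ
  r X = ∣ basis X ∣

  indep⇒∣∣≤r : ∀ {J X} → Indep M J → J ⊆ X → ∣ J ∣ ≤ r X
  indep⇒∣∣≤r {X = X} = maximal⇒maximum (basis-indep X) (extend-maximal ⊥ X)

  r≤∣∣ : ∀ X → r X ≤ ∣ X ∣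
  r≤∣∣ X = p⊆q⇒∣p∣≤∣q∣ (basis-⊆ X)

  r-mono : ∀ {X Y} → X ⊆ Y → r X ≤ r Y
  r-mono {X} X⊆Y = indep⇒∣∣≤r (basis-indep X) (λ x∈B → X⊆Y (basis-⊆ X x∈B))

  ∣∣≤r⇒indep : ∀ {X} → ∣ X ∣ ≤ r X → Indep M X
  ∣∣≤r⇒indep {X} ∣X∣≤rX = hereditary M (p⊆q∧∣q∣≤∣p∣⇒q⊆p (basis-⊆ X) ∣X∣≤rX) (basis-indep X)

  -- K extends a basis of X ∩ Y to one of X ∪ Y; its traces on X and on Y witness the inequality.
  r-submodular : ∀ X Y → r (X ∪ Y) + r (X ∩ Y) ≤ r X + r Y
  r-submodular X Y = begin
    r (X ∪ Y) + r (X ∩ Y)        ≤⟨ +-monoˡ-≤ _ (maximal⇒maximum indK (extend-maximal I₀ (X ∪ Y))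
                                                  (basis-indep (X ∪ Y)) (basis-⊆ (X ∪ Y))) ⟩
    ∣ K ∣ + ∣ I₀ ∣                ≤⟨ +-mono-≤ (p⊆q⇒∣p∣≤∣q∣ K⊆KX∪KY) (p⊆q⇒∣p∣≤∣q∣ I₀⊆KX∩KY) ⟩
    ∣ KX ∪ KY ∣ + ∣ KX ∩ KY ∣     ≡⟨ ∣p∪q∣+∣p∩q∣≡∣p∣+∣q∣ KX KY ⟩
    ∣ KX ∣ + ∣ KY ∣               ≤⟨ +-mono-≤ (indep⇒∣∣≤r (hereditary M (p∩q⊆p K X) indK) (p∩q⊆q K X))
                                              (indep⇒∣∣≤r (hereditary M (p∩q⊆p K Y) indK) (p∩q⊆q K Y)) ⟩
    r X + r Y                     ∎
    where
    I₀ = basis (X ∩ Y)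
    K  = extend I₀ (X ∪ Y)
    KX = K ∩ X
    KY = K ∩ Y
    indK : Indep M K
    indK = greedy-indep (X ∪ Y) (List.allFin n) (basis-indep (X ∩ Y))
    K⊆X∪Y : K ⊆ X ∪ Y
    K⊆X∪Y x∈K with x∈p∪q⁻ I₀ (X ∪ Y) (greedy-⊆ (X ∪ Y) (List.allFin n) x∈K)
    ... | inj₁ x∈I₀ = p⊆p∪q Y (p∩q⊆p X Y (basis-⊆ (X ∩ Y) x∈I₀))
    ... | inj₂ x∈X∪Y = x∈X∪Y
    K⊆KX∪KY : K ⊆ KX ∪ KY
    K⊆KX∪KY x∈K = [ (λ x∈X → p⊆p∪q KY (x∈p∩q⁺ (x∈K , x∈X))) , (λ x∈Y → q⊆p∪q KX KY (x∈p∩q⁺ (x∈K , x∈Y))) ]′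
                    (x∈p∪q⁻ X Y (K⊆X∪Y x∈K))
    I₀⊆KX∩KY : I₀ ⊆ KX ∩ KY
    I₀⊆KX∩KY x∈I₀ with x∈p∩q⁻ X Y (basis-⊆ (X ∩ Y) x∈I₀)
    ... | x∈X , x∈Y = let x∈K = greedy-⊇ (X ∪ Y) (List.allFin n) x∈I₀ in
                      x∈p∩q⁺ (x∈p∩q⁺ (x∈K , x∈X) , x∈p∩q⁺ (x∈K , x∈Y))

  r-uncross : ∀ Z a {S T y} → y ∈ T →
              r (Z ∪ ((S ∪ T) ∩ a)) + r (Z ∪ (((S ∩ T) - y) ∩ a)) ≤
              r (Z ∪ (S ∩ (a - y))) + r (Z ∪ (T ∩ a))
  r-uncross Z a {S} {T} {y} y∈T = begin
    r (Z ∪ ((S ∪ T) ∩ a)) + r (Z ∪ (((S ∩ T) - y) ∩ a)) ≤⟨ +-mono-≤ (r-mono ⊆X₁∪X₂) (r-mono ⊆X₁∩X₂) ⟩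
    r (X₁ ∪ X₂) + r (X₁ ∩ X₂)                             ≤⟨ r-submodular X₁ X₂ ⟩
    r X₁ + r X₂                                           ∎
    where
    X₁ = Z ∪ (S ∩ (a - y))
    X₂ = Z ∪ (T ∩ a)
    ⊆X₁∪X₂ : Z ∪ ((S ∪ T) ∩ a) ⊆ X₁ ∪ X₂
    ⊆X₁∪X₂ {x} x∈ with x∈p∪q⁻ Z _ x∈
    ... | inj₁ x∈Z = p⊆p∪q X₂ (p⊆p∪q _ x∈Z)
    ... | inj₂ x∈[S∪T]∩a with x∈p∩q⁻ (S ∪ T) a x∈[S∪T]∩a
    ...   | x∈S∪T , x∈a with x ∈? T
    ...     | yes x∈T = q⊆p∪q X₁ X₂ (q⊆p∪q Z _ (x∈p∩q⁺ (x∈T , x∈a)))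
    ...     | no  x∉T = p⊆p∪q X₂ (q⊆p∪q Z _ (x∈p∩q⁺ (x∈S , x∈p∧x≢y⇒x∈p-y x∈a (λ { refl → x∉T y∈T }))))
      where
      x∈S : x ∈ S
      x∈S = [ (λ x∈S → x∈S) , (λ x∈T → ⊥-elim (x∉T x∈T)) ]′ (x∈p∪q⁻ S T x∈S∪T)
    ⊆X₁∩X₂ : Z ∪ (((S ∩ T) - y) ∩ a) ⊆ X₁ ∩ X₂
    ⊆X₁∩X₂ {x} x∈ with x∈p∪q⁻ Z _ x∈
    ... | inj₁ x∈Z = x∈p∩q⁺ (p⊆p∪q _ x∈Z , p⊆p∪q _ x∈Z)
    ... | inj₂ x∈V∩a with x∈p∩q⁻ ((S ∩ T) - y) a x∈V∩a
    ...   | x∈V , x∈a with x∈p∩q⁻ S T (p─q⊆p (S ∩ T) ⁅ y ⁆ x∈V)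
    ...     | x∈S , x∈T = x∈p∩q⁺ ( q⊆p∪q Z _ (x∈p∩q⁺ (x∈S , x∈p∧x≢y⇒x∈p-y x∈a (x∈p-y⇒x≢y (S ∩ T) x∈V)))
                                 , q⊆p∪q Z _ (x∈p∩q⁺ (x∈T , x∈a)))

  ∣∣+∣∣≤r+r⇒indep : ∀ {X W} → ∣ X ∣ + ∣ W ∣ ≤ r X + r W → Indep M X × Indep M W
  ∣∣+∣∣≤r+r⇒indep {X} {W} ∣X∣+∣W∣≤rX+rW =
      ∣∣≤r⇒indep (+-cancelʳ-≤ (∣ W ∣) (∣ X ∣) (r X) (≤-trans ∣X∣+∣W∣≤rX+rW (+-monoʳ-≤ (r X) (r≤∣∣ W))))
    , ∣∣≤r⇒indep (+-cancelˡ-≤ (∣ X ∣) (∣ W ∣) (r W) (≤-trans ∣X∣+∣W∣≤rX+rW (+-monoˡ-≤ (r W) (r≤∣∣ X))))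

-- Sharing an independent set between the two halves of another

record Split {n} (M : Matroid n) (P Q Y : Subset n) : Set where
  field
    left          : Subset n
    right         : Subset n
    left⊆Y        : left ⊆ Y
    Y⊆left∪right  : Y ⊆ left ∪ right
    indep-P∪left  : Indep M (P ∪ left)
    indep-Q∪right : Indep M (Q ∪ right)

module _ {n : ℕ} (M : Matroid n) {P Q Y : Subset n}
         (P∩Q-empty : Empty (P ∩ Q)) (indP∪Q : Indep M (P ∪ Q)) (indY : Indep M Y) where
  open Rank M

  -- Elements of Y in a may join P and those in b may join Q; feasibility is Rado's condition.
  Bounded : Subset n → Subset n → Subset n → Set
  Bounded a b S = ∣ P ∣ + ∣ Q ∣ + ∣ S ∣ ≤ r (P ∪ (S ∩ a)) + r (Q ∪ (S ∩ b))

  Feasible : Subset n → Subset n → Set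
  Feasible a b = ∀ S → S ⊆ Y → Bounded a b S

  Violated : Subset n → Subset n → Set
  Violated a b = ∃ λ S → S ⊆ Y × r (P ∪ (S ∩ a)) + r (Q ∪ (S ∩ b)) < ∣ P ∣ + ∣ Q ∣ + ∣ S ∣

  violated? : ∀ a b → Dec (Violated a b)
  violated? a b = anySubset? (λ S → (S ⊆? Y) ×-dec (_ <? _))

  ¬violated⇒feasible : ∀ {a b} → ¬ Violated a b → Feasible a b
  ¬violated⇒feasible ¬v S S⊆Y = ≮⇒≥ (λ v → ¬v (S , S⊆Y , v))

  feasible-⊤ : Feasible ⊤ ⊤
  feasible-⊤ S S⊆Y = begin
    ∣ P ∣ + ∣ Q ∣ + ∣ S ∣       ≡⟨ cong (_+ ∣ S ∣) (sym (∣p∪q∣≡∣p∣+∣q∣ P Q P∩Q-empty)) ⟩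
    ∣ P ∪ Q ∣ + ∣ S ∣           ≤⟨ +-mono-≤ (indep⇒∣∣≤r indP∪Q P∪Q⊆X∪W) (indep⇒∣∣≤r (hereditary M S⊆Y indY) S⊆X∩W) ⟩
    r (X ∪ W) + r (X ∩ W)       ≤⟨ r-submodular X W ⟩
    r X + r W                   ∎
    where
    X = P ∪ (S ∩ ⊤)
    W = Q ∪ (S ∩ ⊤)
    P∪Q⊆X∪W : P ∪ Q ⊆ X ∪ W
    P∪Q⊆X∪W x∈ = [ (λ x∈P → p⊆p∪q W (p⊆p∪q _ x∈P)) , (λ x∈Q → q⊆p∪q X W (p⊆p∪q _ x∈Q)) ]′ (x∈p∪q⁻ P Q x∈)
    S⊆X∩W : S ⊆ X ∩ W
    S⊆X∩W x∈S = x∈p∩q⁺ (q⊆p∪q P _ (x∈p∩q⁺ (x∈S , ∈⊤)) , q⊆p∪q Q _ (x∈p∩q⁺ (x∈S , ∈⊤)))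

  -- A set avoiding y violates after removing y only if it already did, so both violators contain y;
  -- adding the two violated inequalities and uncrossing them on each side overshoots by one.
  ¬violated-both : ∀ {a b} y → Feasible a b → Violated (a - y) b → Violated a (b - y) → ⊥₀
  ¬violated-both {a} {b} y F (S₁ , S₁⊆Y , v₁) (S₂ , S₂⊆Y , v₂) with y ∈? S₁ | y ∈? S₂
  ... | no y∉S₁ | _ = <⇒≱ v₁ (≤-trans (F S₁ S₁⊆Y)
                         (+-monoˡ-≤ _ (r-mono (∪-monoʳ-⊆ P (y∉p⇒p∩q⊆p∩[q-y] y∉S₁)))))
  ... | yes _   | no y∉S₂ = <⇒≱ v₂ (≤-trans (F S₂ S₂⊆Y)
                         (+-monoʳ-≤ _ (r-mono (∪-monoʳ-⊆ Q (y∉p⇒p∩q⊆p∩[q-y] y∉S₂)))))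
  ... | yes y∈S₁ | yes y∈S₂ = <-irrefl refl (begin-strict
    (c + ∣ S₁ ∣) + (c + ∣ S₂ ∣)                  ≡⟨ +-interchange c (∣ S₁ ∣) c (∣ S₂ ∣) ⟩
    (c + c) + (∣ S₁ ∣ + ∣ S₂ ∣)                  ≡⟨ cong ((c + c) +_) (sym (∣p∪q∣+∣p∩q∣≡∣p∣+∣q∣ S₁ S₂)) ⟩
    (c + c) + (∣ U ∣ + ∣ S₁ ∩ S₂ ∣)              ≤⟨ +-monoʳ-≤ (c + c) (+-monoʳ-≤ ∣ U ∣ (∣p∣≤1+∣p-x∣ (S₁ ∩ S₂) y)) ⟩
    (c + c) + (∣ U ∣ + suc ∣ V ∣)                ≡⟨ cong ((c + c) +_) (+-suc (∣ U ∣) (∣ V ∣)) ⟩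
    (c + c) + suc (∣ U ∣ + ∣ V ∣)                ≡⟨ +-suc (c + c) _ ⟩
    suc ((c + c) + (∣ U ∣ + ∣ V ∣))              ≡⟨ cong suc (+-interchange c c (∣ U ∣) (∣ V ∣)) ⟩
    suc ((c + ∣ U ∣) + (c + ∣ V ∣))              ≤⟨ s≤s (+-mono-≤ (F U U⊆Y) (F V V⊆Y)) ⟩
    suc ((r PU + r QU) + (r PV + r QV))          ≡⟨ cong suc (+-interchange (r PU) (r QU) (r PV) (r QV)) ⟩
    suc ((r PU + r PV) + (r QU + r QV))          ≤⟨ s≤s (+-mono-≤ (r-uncross P a y∈S₂) Q-side) ⟩
    suc ((r X₁ + r X₂) + (r W₁ + r W₂))          ≡⟨ cong suc (+-interchange (r X₁) (r X₂) (r W₁) (r W₂)) ⟩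
    suc ((r X₁ + r W₁) + (r X₂ + r W₂))          <⟨ s≤s (≤-reflexive (sym (+-suc (r X₁ + r W₁) (r X₂ + r W₂)))) ⟩
    suc (r X₁ + r W₁) + suc (r X₂ + r W₂)        ≤⟨ +-mono-≤ v₁ v₂ ⟩
    (c + ∣ S₁ ∣) + (c + ∣ S₂ ∣)                  ∎)
    where
    c  = ∣ P ∣ + ∣ Q ∣
    U  = S₁ ∪ S₂
    V  = (S₁ ∩ S₂) - y
    PU = P ∪ (U ∩ a)
    QU = Q ∪ (U ∩ b)
    PV = P ∪ (V ∩ a)
    QV = Q ∪ (V ∩ b)
    X₁ = P ∪ (S₁ ∩ (a - y))
    W₁ = Q ∪ (S₁ ∩ b)
    X₂ = P ∪ (S₂ ∩ a)
    W₂ = Q ∪ (S₂ ∩ (b - y))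
    U⊆Y : U ⊆ Y
    U⊆Y x∈U = [ S₁⊆Y , S₂⊆Y ]′ (x∈p∪q⁻ S₁ S₂ x∈U)
    V⊆Y : V ⊆ Y
    V⊆Y x∈V = S₁⊆Y (p∩q⊆p S₁ S₂ (p─q⊆p (S₁ ∩ S₂) ⁅ y ⁆ x∈V))
    Q-side : r QU + r QV ≤ r W₁ + r W₂
    Q-side = subst₂ _≤_
      (cong₂ (λ U′ I′ → r (Q ∪ (U′ ∩ b)) + r (Q ∪ ((I′ - y) ∩ b))) (∪-comm S₂ S₁) (∩-comm S₂ S₁))
      (+-comm (r W₂) (r W₁))
      (r-uncross Q b y∈S₁)

  feasible-remove : ∀ {a b} y → Feasible a b → Feasible (a - y) b ⊎ Feasible a (b - y)
  feasible-remove {a} {b} y F with violated? (a - y) b | violated? a (b - y)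
  ... | no ¬v₁ | _      = inj₁ (¬violated⇒feasible ¬v₁)
  ... | yes _  | no ¬v₂ = inj₂ (¬violated⇒feasible ¬v₂)
  ... | yes v₁ | yes v₂ = ⊥-elim (¬violated-both y F v₁ v₂)

  feasible-disjoint⇒split : ∀ {a b} → Y ⊆ a ∪ b → Empty (Y ∩ (a ∩ b)) → Feasible a b → Split M P Q Y
  feasible-disjoint⇒split {a} {b} Y⊆a∪b empty F = record
    { left          = A
    ; right         = R
    ; left⊆Y        = p∩q⊆p Y a
    ; Y⊆left∪right  = Y⊆A∪R
    ; indep-P∪left  = proj₁ indep-both
    ; indep-Q∪right = proj₂ indep-both
    }
    where
    A = Y ∩ a
    R = Y ∩ b
    Y⊆A∪R : Y ⊆ A ∪ R
    Y⊆A∪R x∈Y = [ (λ x∈a → p⊆p∪q R (x∈p∩q⁺ (x∈Y , x∈a))) , (λ x∈b → q⊆p∪q A R (x∈p∩q⁺ (x∈Y , x∈b))) ]′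
                  (x∈p∪q⁻ a b (Y⊆a∪b x∈Y))
    A∩R-empty : Empty (A ∩ R)
    A∩R-empty (x , x∈A∩R) with x∈p∩q⁻ A R x∈A∩R
    ... | x∈A , x∈R = empty (x , x∈p∩q⁺ (p∩q⊆p Y a x∈A , x∈p∩q⁺ (p∩q⊆q Y a x∈A , p∩q⊆q Y b x∈R)))
    A∪R⊆Y : A ∪ R ⊆ Y
    A∪R⊆Y x∈ = [ p∩q⊆p Y a , p∩q⊆p Y b ]′ (x∈p∪q⁻ A R x∈)
    indep-both : Indep M (P ∪ A) × Indep M (Q ∪ R)
    indep-both = ∣∣+∣∣≤r+r⇒indep (begin
      ∣ P ∪ A ∣ + ∣ Q ∪ R ∣              ≤⟨ +-mono-≤ (∣p∪q∣≤∣p∣+∣q∣ P A) (∣p∪q∣≤∣p∣+∣q∣ Q R) ⟩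
      (∣ P ∣ + ∣ A ∣) + (∣ Q ∣ + ∣ R ∣)  ≡⟨ +-interchange (∣ P ∣) (∣ A ∣) (∣ Q ∣) (∣ R ∣) ⟩
      (∣ P ∣ + ∣ Q ∣) + (∣ A ∣ + ∣ R ∣)  ≡⟨ cong ((∣ P ∣ + ∣ Q ∣) +_) (sym (∣p∪q∣≡∣p∣+∣q∣ A R A∩R-empty)) ⟩
      ∣ P ∣ + ∣ Q ∣ + ∣ A ∪ R ∣          ≤⟨ +-monoʳ-≤ (∣ P ∣ + ∣ Q ∣) (p⊆q⇒∣p∣≤∣q∣ A∪R⊆Y) ⟩
      ∣ P ∣ + ∣ Q ∣ + ∣ Y ∣              ≤⟨ F Y ⊆-refl ⟩
      r (P ∪ A) + r (Q ∪ R)              ∎)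

  split-from : ∀ a b → Acc _<_ (∣ a ∣ + ∣ b ∣) → Y ⊆ a ∪ b → Feasible a b → Split M P Q Y
  split-from a b (acc rec) Y⊆a∪b F with nonempty? (Y ∩ (a ∩ b))
  ... | no  empty = feasible-disjoint⇒split Y⊆a∪b empty F
  ... | yes (y , y∈Y∩a∩b) with x∈p∩q⁻ a b (p∩q⊆q Y (a ∩ b) y∈Y∩a∩b) | feasible-remove y F
  ...   | y∈a , y∈b | inj₁ F′ = split-from (a - y) b (rec (+-monoˡ-< ∣ b ∣ (x∈p⇒∣p-x∣<∣p∣ y∈a)))
                                  (λ x∈Y → y∈q⇒p∪q⊆[p-y]∪q y∈b (Y⊆a∪b x∈Y)) F′
  ...   | y∈a , y∈b | inj₂ F′ = split-from a (b - y) (rec (+-monoʳ-< ∣ a ∣ (x∈p⇒∣p-x∣<∣p∣ y∈b)))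
                                  (λ x∈Y → y∈p⇒p∪q⊆p∪[q-y] y∈a (Y⊆a∪b x∈Y)) F′

  split : Split M P Q Y
  split = split-from ⊤ ⊤ (<-wellFounded _) (λ _ → p⊆p∪q ⊤ ∈⊤) feasible-⊤

-- Alice wins with χ(M) colors

total : ∀ {n} → (Fin n → ℕ) → ℕ
total {zero}  f = 0
total {suc n} f = f zero + total (λ e → f (suc e))

total-mono-≤ : ∀ {n} {f g : Fin n → ℕ} → (∀ e → f e ≤ g e) → total f ≤ total g
total-mono-≤ {zero}  f≤g = z≤n
total-mono-≤ {suc n} f≤g = +-mono-≤ (f≤g zero) (total-mono-≤ (λ e → f≤g (suc e)))

total-mono-< : ∀ {n} {f g : Fin n → ℕ} → (∀ e → f e ≤ g e) → ∀ e₀ → f e₀ < g e₀ → total f < total g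
total-mono-< {suc n} f≤g zero     f<g = +-mono-<-≤ f<g (total-mono-≤ (λ e → f≤g (suc e)))
total-mono-< {suc n} f≤g (suc e₀) f<g = +-mono-≤-< (f≤g zero) (total-mono-< (λ e → f≤g (suc e)) e₀ f<g)

insert-∈ : ∀ {n} {B : Subset n} (s : Sizes n) {e} → e ∈ B → insert B s e ≡ suc (s e)
insert-∈ {B = B} s {e} e∈B rewrite []=⇒lookup e∈B = refl

insert-∉ : ∀ {n} {B : Subset n} (s : Sizes n) {e} → e ∉ B → insert B s e ≡ s e
insert-∉ {B = B} s {e} e∉B with lookup B e in lookup≡
... | true  = ⊥-elim (e∉B (lookup⇒[]= e B lookup≡))
... | false = refl

-- Every round fills at least one of these empty list slots.
slack : ∀ {n} → ℕ → Sizes n → ℕ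
slack k s = total (λ e → k ∸ s e)

slack-insert : ∀ {n} k (s : Sizes n) B → LegalBob k s B → slack k (insert B s) < slack k s
slack-insert k s B ((e₀ , e₀∈B) , below-k) = total-mono-< fewer e₀ strictly-fewer
  where
  fewer : ∀ e → k ∸ insert B s e ≤ k ∸ s e
  fewer e with e ∈? B
  ... | yes e∈B = ∸-monoʳ-≤ k (subst (s e ≤_) (sym (insert-∈ s e∈B)) (n≤1+n (s e)))
  ... | no  e∉B = ≤-reflexive (cong (k ∸_) (insert-∉ s e∉B))
  strictly-fewer : k ∸ insert B s e₀ < k ∸ s e₀
  strictly-fewer rewrite insert-∈ s e₀∈B = ∸-monoʳ-< (n<1+n (s e₀)) (below-k e₀ e₀∈B)

module _ {n : ℕ} (M : Matroid n) where

  CoveredWithin : List (Subset n) → ℕ → Fin n → Set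
  CoveredWithin Js m e = Any (e ∈_) (take m Js)

  record Refinement (B : Subset n) (Js : List (Subset n)) : Set where
    field
      answer        : Subset n
      answer⊆B      : answer ⊆ B
      indep-answer  : Indep M answer
      classes       : List (Subset n)
      indep-classes : All (Indep M) classes
      advance       : ∀ {m e} → e ∈ B → CoveredWithin Js (suc m) e → e ∈ answer ⊎ CoveredWithin classes m e
      retain        : ∀ {m e} → e ∉ B → CoveredWithin Js m e → CoveredWithin classes m e

  refine : ∀ B Js → All (Indep M) Js → Refinement B Js
  refine B [] [] = record
    { answer        = ⊥
    ; answer⊆B      = λ x∈⊥ → ⊥-elim (∉⊥ x∈⊥)
    ; indep-answer  = indep-∅ M
    ; classes       = []
    ; indep-classes = []
    ; advance       = λ _ ()
    ; retain        = λ _ covered → covered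
    }
  refine B (J ∷ Js) (indJ ∷ indJs) = record
    { answer        = (J ∩ B) ∪ left
    ; answer⊆B      = λ x∈ → [ p∩q⊆q J B , (λ x∈left → answer⊆B (left⊆Y x∈left)) ]′ (x∈p∪q⁻ (J ∩ B) left x∈)
    ; indep-answer  = indep-P∪left
    ; classes       = ((J ─ B) ∪ right) ∷ classes
    ; indep-classes = indep-Q∪right ∷ indep-classes
    ; advance       = advance′
    ; retain        = retain′
    }
    where
    open Refinement (refine B Js indJs)
    halves-disjoint : Empty ((J ∩ B) ∩ (J ─ B))
    halves-disjoint (x , x∈) with x∈p∩q⁻ (J ∩ B) (J ─ B) x∈
    ... | x∈J∩B , x∈J─B = x∈p─q⇒x∉q J B x∈J─B (p∩q⊆q J B x∈J∩B)
    indep-halves : Indep M ((J ∩ B) ∪ (J ─ B))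
    indep-halves = hereditary M (λ x∈ → [ p∩q⊆p J B , p─q⊆p J B ]′ (x∈p∪q⁻ (J ∩ B) (J ─ B) x∈)) indJ
    open Split (split M halves-disjoint indep-halves indep-answer)
    advance′ : ∀ {m e} → e ∈ B → CoveredWithin (J ∷ Js) (suc m) e →
               e ∈ (J ∩ B) ∪ left ⊎ CoveredWithin (((J ─ B) ∪ right) ∷ classes) m e
    advance′ e∈B (here e∈J) = inj₁ (p⊆p∪q left (x∈p∩q⁺ (e∈J , e∈B)))
    advance′ {suc m} e∈B (there covered) with advance e∈B covered
    ... | inj₂ covered′ = inj₂ (there covered′)
    ... | inj₁ e∈answer with x∈p∪q⁻ left right (Y⊆left∪right e∈answer)
    ...   | inj₁ e∈left  = inj₁ (q⊆p∪q (J ∩ B) left e∈left)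
    ...   | inj₂ e∈right = inj₂ (here (q⊆p∪q (J ─ B) right e∈right))
    retain′ : ∀ {m e} → e ∉ B → CoveredWithin (J ∷ Js) m e → CoveredWithin (((J ─ B) ∪ right) ∷ classes) m e
    retain′ {suc m} e∉B (here e∈J)     = here (p⊆p∪q right (x∈p∧x∉q⇒x∈p─q e∈J e∉B))
    retain′ {suc m} e∉B (there covered) = there (retain e∉B covered)

  Invariant : ℕ → Sizes n → Subset n → Set
  Invariant k s col = ∃ λ Js → All (Indep M) Js × (∀ e → e ∉ col → CoveredWithin Js (k ∸ s e) e)

  invariant⇒wins : ∀ {k s col} → Acc _<_ (slack k s) → Invariant k s col → AliceWinsFrom M k s col
  invariant⇒wins {k} {s} {col} (acc rec) (Js , indJs , covered) with Fin.all? (λ e → s e ≟ k)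
  ... | yes ended = finished ended colored
    where
    colored : ∀ e → e ∈ col
    colored e with e ∈? col
    ... | yes e∈col = e∈col
    ... | no  e∉col = ⊥-elim (Any.¬Any[] (subst (λ m → CoveredWithin Js m e)
                                             (trans (cong (k ∸_) (ended e)) (n∸n≡0 k)) (covered e e∉col)))
  ... | no ¬ended = round ¬ended respond
    where
    respond : ∀ B → LegalBob k s B →
              ∃ λ A → A ⊆ B ─ col × Indep M A × AliceWinsFrom M k (insert B s) (col ∪ A)
    respond B legal@(_ , below-k) =
      answer , answer⊆B , indep-answer ,
      invariant⇒wins (rec (slack-insert k s B legal)) (classes , indep-classes , covered′)
      where
      open Refinement (refine (B ─ col) Js indJs)
      covered′ : ∀ e → e ∉ col ∪ answer → CoveredWithin classes (k ∸ insert B s e) e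
      covered′ e e∉ = still-covered (λ e∈col → e∉ (p⊆p∪q answer e∈col))
                                    (λ e∈answer → e∉ (q⊆p∪q col answer e∈answer)) (e ∈? B)
        where
        still-covered : e ∉ col → e ∉ answer → Dec (e ∈ B) → CoveredWithin classes (k ∸ insert B s e) e
        still-covered e∉col _ (no e∉B) =
          subst (λ m → CoveredWithin classes m e) (cong (k ∸_) (sym (insert-∉ s e∉B)))
                (retain (λ e∈B─col → e∉B (p─q⊆p B col e∈B─col)) (covered e e∉col))
        still-covered e∉col e∉answer (yes e∈B)
          with advance (x∈p∧x∉q⇒x∈p─q e∈B e∉col)
                       (subst (λ m → CoveredWithin Js m e) (m∸n≡1+[m∸1+n] (below-k e e∈B)) (covered e e∉col))
        ... | inj₁ e∈answer = ⊥-elim (e∉answer e∈answer)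
        ... | inj₂ covered″ = subst (λ m → CoveredWithin classes m e) (cong (k ∸_) (sym (insert-∈ s e∈B))) covered″

  colorable⇒aliceWins : ∀ {c} → Colorable M c → AliceWins M c
  colorable⇒aliceWins {c} (f , proper) = invariant⇒wins (<-wellFounded _) (classes , All.tabulate⁺ proper , covered)
    where
    classes : List (Subset n)
    classes = List.tabulate (colorClass f)
    covered : ∀ e → e ∉ ⊥ → CoveredWithin classes (c ∸ 0) e
    covered e _ rewrite take-all c classes (≤-reflexive (length-tabulate (colorClass f))) =
      Any.tabulate⁺ (f e) (colorClass⁺ f e)

-- Alice needs χ(M) colors

module _ {n : ℕ} (M : Matroid n) where

  InIndependent : (Fin n → Set) → Set
  InIndependent P = ∃ λ S → Indep M S × (∀ e → P e → e ∈ S)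

  -- g e is the round, counted from i, in which e is colored if Bob always offers the whole ground set.
  RoundLabelling : ℕ → ℕ → Subset n → Set
  RoundLabelling k i col = Σ (Fin n → ℕ) λ g →
    (∀ e → e ∉ col → i ≤ g e × g e < k) × (∀ j → InIndependent (λ e → e ∉ col × g e ≡ j))

  labelling-step : ∀ {k i col A} → i < k → Indep M A →
                   RoundLabelling k (suc i) (col ∪ A) → RoundLabelling k i col
  labelling-step {k} {i} {col} {A} i<k indA (g′ , bounds′ , classes′) = g , bounds , classes
    where
    g : Fin n → ℕ
    g e = if does (e ∈? A) then i else g′ e
    e∉col∪A : ∀ {e} → e ∉ col → e ∉ A → e ∉ col ∪ A
    e∉col∪A e∉col e∉A e∈ = [ e∉col , e∉A ]′ (x∈p∪q⁻ col A e∈)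
    bounds : ∀ e → e ∉ col → i ≤ g e × g e < k
    bounds e e∉col with e ∈? A
    ... | yes _   = ≤-refl , i<k
    ... | no  e∉A = map₁ (≤-trans (n≤1+n i)) (bounds′ e (e∉col∪A e∉col e∉A))
    classes : ∀ j → InIndependent (λ e → e ∉ col × g e ≡ j)
    classes j with j ≟ i
    ... | yes refl = A , indA , in-A
      where
      in-A : ∀ e → e ∉ col × g e ≡ i → e ∈ A
      in-A e (e∉col , ge≡i) with e ∈? A
      ... | yes e∈A = e∈A
      ... | no  e∉A = ⊥-elim (<-irrefl (sym ge≡i) (proj₁ (bounds′ e (e∉col∪A e∉col e∉A))))
    ... | no j≢i with classes′ j
    ...   | S , indS , in-S = S , indS , in-S′
      where
      in-S′ : ∀ e → e ∉ col × g e ≡ j → e ∈ S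
      in-S′ e (e∉col , ge≡j) with e ∈? A
      ... | yes _   = ⊥-elim (j≢i (sym ge≡j))
      ... | no  e∉A = in-S e (e∉col∪A e∉col e∉A , ge≡j)

  labelling-from-win : ∀ {k} d i {s col} → Fin n → i + d ≡ k → (∀ e → s e ≡ i) →
           AliceWinsFrom M k s col → RoundLabelling k i col
  labelling-from-win d i _ _ _ (finished _ all-colored) =
    (λ _ → 0) , (λ e e∉col → ⊥-elim (e∉col (all-colored e))) ,
    (λ j → ⊥ , indep-∅ M , λ e (e∉col , _) → ⊥-elim (e∉col (all-colored e)))
  labelling-from-win zero i _ i+0≡k s≡i (round ¬ended _) =
    ⊥-elim (¬ended (λ e → trans (s≡i e) (trans (sym (+-identityʳ i)) i+0≡k)))
  labelling-from-win {k} (suc d) i {s} e₀ i+d≡k s≡i (round _ respond) =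
    let A , _ , indA , wins = respond ⊤ ((e₀ , ∈⊤) , λ e _ → subst (_< k) (sym (s≡i e)) i<k)
    in labelling-step i<k indA
         (labelling-from-win d (suc i) e₀ (trans (sym (+-suc i d)) i+d≡k)
                             (λ e → trans (insert-∈ s ∈⊤) (cong suc (s≡i e))) wins)
    where
    i<k : i < k
    i<k = subst (i <_) i+d≡k (m<m+n i z<s)

aliceWins⇒colorable : ∀ {n} (M : Matroid n) {k} → AliceWins M k → Colorable M k
aliceWins⇒colorable {zero}  M     _    = (λ ()) , λ _ → indep-∅ M
aliceWins⇒colorable {suc n} M {k} wins with labelling-from-win M k 0 zero refl (λ _ → refl) wins
... | g , bounds , classes = f , proper
  where
  f : Fin (suc n) → Fin k
  f e = fromℕ< (proj₂ (bounds e ∉⊥))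
  proper : ProperColoring M k f
  proper c with classes (toℕ c)
  ... | S , indS , in-S = hereditary M (λ {e} e∈class → in-S e (∉⊥ , g≡c e∈class)) indS
    where
    g≡c : ∀ {e} → e ∈ colorClass f c → g e ≡ toℕ c
    g≡c {e} e∈class = trans (sym (Fin.toℕ-fromℕ< (proj₂ (bounds e ∉⊥)))) (cong toℕ (colorClass⁻ f e∈class))

-- Looplessness only guarantees that χ(M) exists, which the hypothesis on c already provides.
theorem2 : ∀ {n} (M : Matroid n) → Loopless M → (c : ℕ) →
    IsMinimum (Colorable M) c → IsMinimum (AliceWins M) c
theorem2 M _ c (colorable , minimal) =
  colorable⇒aliceWins M colorable , λ k wins → minimal k (aliceWins⇒colorable M wins)
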